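{- Let $K$ be a field, $n\ge 2$, and let $C=(c_{i,j})_{1\le i,j\le n}$ be a frieze matrix over $K$. Then for all $1\le i\le n-1$, $$c_{i,n}c_{1,i+1}-c_{i+1,n}c_{1,i} = c_{i,i+1}c_{1,n}.$$
   Context: A frieze matrix (in the sense of Maldonado) is a symmetric $n\times n$ matrix $C=(c_{i,j})$ over $K$ such that $c_{i,j}=0$ if and only if $i=j$, and which satisfies the generalized diamond rule $c_{i,j}c_{i+1,j+1}-c_{i+1,j}c_{i,j+1}=c_{i,i+1}c_{j,j+1}$ for all indices with $2\le i+1\le j\le n-1$. -}

module Defs where

open import Level using (Level; _⊔_) renaming (suc to lsuc)
open import Algebra.Bundles using (CommutativeRing)
open import Data.Nat using (ℕ; suc; _≤_; _∸_)
open import Relation.Binary.PropositionalEquality using (_≡_)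
open import Data.Product using (Σ; _×_)
open import Relation.Nullary using (¬_)

record Field (c ℓ : Level) : Set (lsuc (c ⊔ ℓ)) where
  field
    commutativeRing : CommutativeRing c ℓ
  open CommutativeRing commutativeRing public
  field
    0≉1     : ¬ (0# ≈ 1#)
    inverse : ∀ x → ¬ (x ≈ 0#) → Σ Carrier (λ y → x * y ≈ 1#)

-- An n×n matrix over K, indexed by 1 ≤ i, j ≤ n (values of the function
-- outside this range are ignored).
Matrix : ∀ {c ℓ} → Field c ℓ → Set c
Matrix K = ℕ → ℕ → Field.Carrier K

record IsFriezeMatrix {c ℓ} (K : Field c ℓ) (n : ℕ) (C : Matrix K) : Set (c ⊔ ℓ) where
  open Field K
  field
    symmetric : ∀ i j → 1 ≤ i → i ≤ n → 1 ≤ j → j ≤ n → C i j ≈ C j i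
    zero-diag : ∀ i → 1 ≤ i → i ≤ n → C i i ≈ 0#
    nonzero-off : ∀ i j → 1 ≤ i → i ≤ n → 1 ≤ j → j ≤ n → ¬ (i ≡ j) → ¬ (C i j ≈ 0#)
    diamond : ∀ i j → 1 ≤ i → suc i ≤ j → j ≤ n ∸ 1 →
      C i j * C (suc i) (suc j) - C (suc i) j * C i (suc j)
        ≈ C i (suc i) * C j (suc j)

module Submission where

-- Since c₁₂ ≠ 0, the first two rows determine the whole matrix: for
-- 2 ≤ i ≤ j, c₁₂ cᵢⱼ is the 2×2 minor [i j] of rows 1, 2 and columns i, j.
-- This goes by induction down each column: multiplying the diamond rule
-- cᵢⱼ cᵢ₊₁,ⱼ₊₁ = cᵢ₊₁,ⱼ cᵢ,ⱼ₊₁ + cᵢ,ᵢ₊₁ cⱼ,ⱼ₊₁ by c₁₂² and expanding the known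
-- entries, the three-term Plücker relation between the minors leaves
-- c₁₂ cᵢⱼ (c₁₂ cᵢ₊₁,ⱼ₊₁ − [i+1 j+1]) = 0, and c₁₂ cᵢⱼ ≠ 0. The proposition
-- is then c₁₂⁻¹ times the identity [i n] c₁,ᵢ₊₁ − [i+1 n] c₁ᵢ = [i i+1] c₁ₙ,
-- which holds for any three columns of a 2-row matrix.

open import Defs
open import Level using (0ℓ)
open import Algebra.Bundles using (CommutativeRing; RawRing)
open import Algebra.Solver.Ring.AlmostCommutativeRing
  using (fromCommutativeRing; _-Raw-AlmostCommutative⟶_)
import Algebra.Solver.Ring
import Algebra.Solver.Ring.NaturalCoefficients.Default as SemiringSolver
import Algebra.Properties.Ring as RingProperties
import Algebra.Properties.Semiring.Mult as SemiringMultiplication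
import Relation.Binary.Reasoning.Setoid as SetoidReasoning
open import Data.Nat as ℕ using (ℕ; zero; suc; _∸_; _≤_; _<_; s≤s; z≤n)
open import Data.Nat.Properties using (m≤n⇒m<n∨m≡n; ≤-refl; ≤-trans; <⇒≤; <⇒≢; n≤1+n)
open import Data.Product using (_×_; _,_; proj₁)
open import Data.Product.Properties using (≡-dec)
open import Data.Sum using (inj₁; inj₂)
open import Data.Maybe using (Maybe; just; nothing)
open import Relation.Nullary using (¬_; yes; no)
open import Relation.Binary.PropositionalEquality as ≡ using (_≡_)

module IntegerCoefficientSolver {c ℓ} (R : CommutativeRing c ℓ) where

  -- A pair (m , n)
  -- stands for the integer m − n; the operations keep one component 0, so
  -- that equal integers are equal pairs and _≡_ decides coefficient equality.
  infix 5 _⊖_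
  _⊖_ : ℕ → ℕ → ℕ × ℕ
  m ⊖ n = (m ∸ n , n ∸ m)

  integers : RawRing 0ℓ 0ℓ
  integers = record
    { Carrier = ℕ × ℕ
    ; _≈_ = _≡_
    ; _+_ = λ { (a , b) (c , d) → a ℕ.+ c ⊖ b ℕ.+ d }
    ; _*_ = λ { (a , b) (c , d) → a ℕ.* c ℕ.+ b ℕ.* d ⊖ a ℕ.* d ℕ.+ b ℕ.* c }
    ; -_ = λ { (a , b) → (b , a) }
    ; 0# = (0 , 0)
    ; 1# = (1 , 0)
    }

  open CommutativeRing R
  open RingProperties ring using (-0#≈0#; -‿involutive; -‿+-comm; -‿distribˡ-*; -‿distribʳ-*)
  open SemiringMultiplication semiring using (×-homo-+; ×1-homo-*) renaming (_×_ to _×ₙ_)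
  open SetoidReasoning setoid
  open SemiringSolver commutativeSemiring using (solve; _:+_; _:*_; _:=_)

  embed : ℕ × ℕ → Carrier
  embed (m , n) = m ×ₙ 1# - n ×ₙ 1#

  embed-suc : ∀ m n → embed (suc m , suc n) ≈ embed (m , n)
  embed-suc m n = begin
    (1# + M) + - (1# + N)     ≈⟨ +-congˡ (-‿+-comm 1# N) ⟨
    (1# + M) + (- 1# + - N)   ≈⟨ solve 4 (λ u x v y → (u :+ x) :+ (v :+ y) := (u :+ v) :+ (x :+ y)) refl 1# M (- 1#) (- N) ⟩
    (1# + - 1#) + (M - N)     ≈⟨ +-congʳ (-‿inverseʳ 1#) ⟩
    0# + (M - N)              ≈⟨ +-identityˡ _ ⟩
    M - N                     ∎
    where
    M = m ×ₙ 1#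
    N = n ×ₙ 1#

  embed-⊖ : ∀ m n → embed (m ⊖ n) ≈ embed (m , n)
  embed-⊖ zero    zero    = refl
  embed-⊖ zero    (suc n) = refl
  embed-⊖ (suc m) zero    = refl
  embed-⊖ (suc m) (suc n) = trans (embed-⊖ m n) (sym (embed-suc m n))

  -x*-y≈x*y : ∀ x y → - x * - y ≈ x * y
  -x*-y≈x*y x y = begin
    - x * - y     ≈⟨ -‿distribˡ-* x (- y) ⟨
    - (x * - y)   ≈⟨ -‿cong (-‿distribʳ-* x y) ⟨
    - (- (x * y)) ≈⟨ -‿involutive _ ⟩
    x * y         ∎

  embed-+ : ∀ a b c d → embed (a ℕ.+ c ⊖ b ℕ.+ d) ≈ embed (a , b) + embed (c , d)
  embed-+ a b c d = begin
    embed (a ℕ.+ c ⊖ b ℕ.+ d)         ≈⟨ embed-⊖ (a ℕ.+ c) (b ℕ.+ d) ⟩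
    (a ℕ.+ c) ×ₙ 1# - (b ℕ.+ d) ×ₙ 1# ≈⟨ +-cong (×-homo-+ 1# a c) (-‿cong (×-homo-+ 1# b d)) ⟩
    (A + C) + - (B + D)               ≈⟨ +-congˡ (-‿+-comm B D) ⟨
    (A + C) + (- B + - D)             ≈⟨ solve 4 (λ x y u v → (x :+ y) :+ (u :+ v) := (x :+ u) :+ (y :+ v)) refl A C (- B) (- D) ⟩
    (A - B) + (C - D)                 ∎
    where
    A = a ×ₙ 1#
    B = b ×ₙ 1#
    C = c ×ₙ 1#
    D = d ×ₙ 1#

  embed-* : ∀ a b c d →
    embed (a ℕ.* c ℕ.+ b ℕ.* d ⊖ a ℕ.* d ℕ.+ b ℕ.* c) ≈ embed (a , b) * embed (c , d)
  embed-* a b c d = begin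
    embed (a ℕ.* c ℕ.+ b ℕ.* d ⊖ a ℕ.* d ℕ.+ b ℕ.* c)
      ≈⟨ embed-⊖ (a ℕ.* c ℕ.+ b ℕ.* d) (a ℕ.* d ℕ.+ b ℕ.* c) ⟩
    (a ℕ.* c ℕ.+ b ℕ.* d) ×ₙ 1# - (a ℕ.* d ℕ.+ b ℕ.* c) ×ₙ 1#
      ≈⟨ +-cong (trans (×-homo-+ 1# (a ℕ.* c) (b ℕ.* d)) (+-cong (×1-homo-* a c) (×1-homo-* b d)))
                (-‿cong (trans (×-homo-+ 1# (a ℕ.* d) (b ℕ.* c)) (+-cong (×1-homo-* a d) (×1-homo-* b c)))) ⟩
    (A * C + B * D) + - (A * D + B * C)
      ≈⟨ +-cong (+-congˡ (sym (-x*-y≈x*y B D))) (trans (sym (-‿+-comm _ _)) (+-cong (-‿distribʳ-* A D) (-‿distribˡ-* B C))) ⟩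
    (A * C + - B * - D) + (A * - D + - B * C)
      ≈⟨ solve 4 (λ x u y v → (x :* y :+ u :* v) :+ (x :* v :+ u :* y) := (x :+ u) :* (y :+ v)) refl A (- B) C (- D) ⟩
    (A - B) * (C - D) ∎
    where
    A = a ×ₙ 1#
    B = b ×ₙ 1#
    C = c ×ₙ 1#
    D = d ×ₙ 1#

  embed-swap : ∀ a b → embed (b , a) ≈ - embed (a , b)
  embed-swap a b = begin
    B - A       ≈⟨ +-comm B (- A) ⟩
    - A + B     ≈⟨ +-congˡ (-‿involutive B) ⟨
    - A + - - B ≈⟨ -‿+-comm A (- B) ⟩
    - (A - B)   ∎
    where
    A = a ×ₙ 1#
    B = b ×ₙ 1#

  homomorphism : integers -Raw-AlmostCommutative⟶ fromCommutativeRing R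
  homomorphism = record
    { ⟦_⟧ = embed
    ; +-homo = λ { (a , b) (c , d) → embed-+ a b c d }
    ; *-homo = λ { (a , b) (c , d) → embed-* a b c d }
    ; -‿homo = λ { (a , b) → embed-swap a b }
    ; 0-homo = -‿inverseʳ 0#
    ; 1-homo = trans (+-congˡ -0#≈0#) (trans (+-identityʳ _) (+-identityʳ _))
    }

  embed-≟ : ∀ x y → Maybe (embed x ≈ embed y)
  embed-≟ x y with ≡-dec ℕ._≟_ ℕ._≟_ x y
  ... | yes ≡.refl = just refl
  ... | no _       = nothing

  open Algebra.Solver.Ring integers (fromCommutativeRing R) homomorphism embed-≟ public

module CommutativeRingProperties {c ℓ} (R : CommutativeRing c ℓ) where
  open CommutativeRing R
  open RingProperties ring using (-0#≈0#)
  open IntegerCoefficientSolver R using (solve; _:+_; _:-_; _:*_; _:=_)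
  open SetoidReasoning setoid

  det₂ : Carrier × Carrier → Carrier × Carrier → Carrier
  det₂ (x₁ , y₁) (x₂ , y₂) = x₁ * y₂ - x₂ * y₁

  det₂-plücker : ∀ u v w z → det₂ u w * det₂ v z ≈ det₂ u v * det₂ w z + det₂ u z * det₂ v w
  det₂-plücker (x₁ , y₁) (x₂ , y₂) (x₃ , y₃) (x₄ , y₄) =
    solve 8 (λ x₁ y₁ x₂ y₂ x₃ y₃ x₄ y₄ →
      (x₁ :* y₃ :- x₃ :* y₁) :* (x₂ :* y₄ :- x₄ :* y₂)
        := (x₁ :* y₂ :- x₂ :* y₁) :* (x₃ :* y₄ :- x₄ :* y₃) :+ (x₁ :* y₄ :- x₄ :* y₁) :* (x₂ :* y₃ :- x₃ :* y₂))
      refl x₁ y₁ x₂ y₂ x₃ y₃ x₄ y₄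

  det₂-first-row : ∀ u v w → det₂ u w * proj₁ v - det₂ v w * proj₁ u ≈ det₂ u v * proj₁ w
  det₂-first-row (x₁ , y₁) (x₂ , y₂) (x₃ , y₃) =
    solve 6 (λ x₁ y₁ x₂ y₂ x₃ y₃ →
      (x₁ :* y₃ :- x₃ :* y₁) :* x₂ :- (x₂ :* y₃ :- x₃ :* y₂) :* x₁ := (x₁ :* y₂ :- x₂ :* y₁) :* x₃)
      refl x₁ y₁ x₂ y₂ x₃ y₃

  x-y*z≈x : ∀ x y {z} → z ≈ 0# → x - y * z ≈ x
  x-y*z≈x x y {z} z≈0 = begin
    x - y * z  ≈⟨ +-congˡ (-‿cong (*-congˡ z≈0)) ⟩
    x - y * 0# ≈⟨ +-congˡ (-‿cong (zeroʳ y)) ⟩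
    x - 0#     ≈⟨ +-congˡ -0#≈0# ⟩
    x + 0#     ≈⟨ +-identityʳ x ⟩
    x          ∎

module FieldProperties {c ℓ} (K : Field c ℓ) where
  open Field K
  open IntegerCoefficientSolver commutativeRing using (solve; _:*_; _:=_)
  open SetoidReasoning setoid

  *-cancelˡ-≉0 : ∀ {x y z} → ¬ (x ≈ 0#) → x * y ≈ x * z → y ≈ z
  *-cancelˡ-≉0 {x} {y} {z} x≉0 xy≈xz with inverse x x≉0
  ... | x⁻¹ , xx⁻¹≈1 = begin
    y              ≈⟨ *-identityˡ y ⟨
    1# * y         ≈⟨ *-congʳ xx⁻¹≈1 ⟨
    (x * x⁻¹) * y  ≈⟨ reassociate x x⁻¹ y ⟩
    x⁻¹ * (x * y)  ≈⟨ *-congˡ xy≈xz ⟩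
    x⁻¹ * (x * z)  ≈⟨ reassociate x x⁻¹ z ⟨
    (x * x⁻¹) * z  ≈⟨ *-congʳ xx⁻¹≈1 ⟩
    1# * z         ≈⟨ *-identityˡ z ⟩
    z              ∎
    where
    reassociate : ∀ a b d → (a * b) * d ≈ b * (a * d)
    reassociate = solve 3 (λ a b d → (a :* b) :* d := b :* (a :* d)) refl

  *-≉0 : ∀ {x y} → ¬ (x ≈ 0#) → ¬ (y ≈ 0#) → ¬ (x * y ≈ 0#)
  *-≉0 {x} x≉0 y≉0 xy≈0 = y≉0 (*-cancelˡ-≉0 x≉0 (trans xy≈0 (sym (zeroʳ x))))

<⇒≤∸1 : ∀ {m n} → m < n → m ≤ n ∸ 1
<⇒≤∸1 (s≤s m≤n) = m≤n

≤∸1⇒< : ∀ {m n} → 1 ≤ n → m ≤ n ∸ 1 → m < n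
≤∸1⇒< (s≤s z≤n) m≤n = s≤s m≤n

module Frieze {c ℓ} {K : Field c ℓ} {n : ℕ} (2≤n : 2 ≤ n) {C : Matrix K} (F : IsFriezeMatrix K n C) where
  open Field K
  open IsFriezeMatrix F
  open CommutativeRingProperties commutativeRing
  open FieldProperties K
  open IntegerCoefficientSolver commutativeRing using (solve; _:+_; _:-_; _:*_; _:=_)
  open SetoidReasoning setoid

  column : ℕ → Carrier × Carrier
  column k = (C 1 k , C 2 k)

  minor : ℕ → ℕ → Carrier
  minor i j = det₂ (column i) (column j)

  Expansion : ℕ → ℕ → Set ℓ
  Expansion i j = C 1 2 * C i j ≈ minor i j

  1≤2 : 1 ≤ 2
  1≤2 = s≤s z≤n

  C₁₂≉0 : ¬ (C 1 2 ≈ 0#)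
  C₁₂≉0 = nonzero-off 1 2 (s≤s z≤n) (≤-trans 1≤2 2≤n) 1≤2 2≤n (λ ())

  expansion-row₂ : ∀ j → Expansion 2 j
  expansion-row₂ j = sym (x-y*z≈x _ (C 1 j) (zero-diag 2 1≤2 2≤n))

  expansion-diagonal : ∀ k → 1 ≤ k → k ≤ n → Expansion k k
  expansion-diagonal k 1≤k k≤n = begin
    C 1 2 * C k k  ≈⟨ *-congˡ (zero-diag k 1≤k k≤n) ⟩
    C 1 2 * 0#     ≈⟨ zeroʳ _ ⟩
    0#             ≈⟨ -‿inverseʳ _ ⟨
    minor k k      ∎

  expansion-adjacent : ∀ k → 2 ≤ k → suc k ≤ n → Expansion k (suc k)
  expansion-adjacent k 2≤k k<n = begin
    C 1 2 * C k (suc k)                       ≈⟨ diamond 1 k (s≤s z≤n) 2≤k (<⇒≤∸1 k<n) ⟨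
    C 1 k * C 2 (suc k) - C 2 k * C 1 (suc k) ≈⟨ +-congˡ (-‿cong (*-comm _ _)) ⟩
    minor k (suc k)                           ∎

  expansion-step : ∀ {i j} → 2 ≤ i → i < j → suc j ≤ n →
    Expansion i j → Expansion (suc i) j → Expansion i (suc j) → Expansion (suc i) (suc j)
  expansion-step {i} {j} 2≤i i<j j<n Eij Ei'j Eij' =
    *-cancelˡ-≉0 (*-≉0 C₁₂≉0 Cij≉0) (begin
      (a * x) * (a * y)
        ≈⟨ solve 5 (λ a x y p q → (a :* x) :* (a :* y) := a :* a :* (x :* y :- p :* q) :+ (a :* q) :* (a :* p))
                   refl a x y p q ⟩
      a * a * (x * y - p * q) + (a * q) * (a * p)
        ≈⟨ +-congʳ (*-congˡ (diamond i j 1≤i i<j (<⇒≤∸1 j<n))) ⟩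
      a * a * (r * s) + (a * q) * (a * p)
        ≈⟨ +-congʳ (solve 3 (λ a r s → a :* a :* (r :* s) := (a :* r) :* (a :* s)) refl a r s) ⟩
      (a * r) * (a * s) + (a * q) * (a * p)
        ≈⟨ +-cong (*-cong (expansion-adjacent i 2≤i i<n) (expansion-adjacent j 2≤j j<n)) (*-cong Eij' Ei'j) ⟩
      minor i (suc i) * minor j (suc j) + minor i (suc j) * minor (suc i) j
        ≈⟨ det₂-plücker (column i) (column (suc i)) (column j) (column (suc j)) ⟨
      minor i j * minor (suc i) (suc j)
        ≈⟨ *-congʳ Eij ⟨
      (a * x) * minor (suc i) (suc j) ∎)
    where
    a = C 1 2
    x = C i j
    y = C (suc i) (suc j)
    p = C (suc i) j
    q = C i (suc j)
    r = C i (suc i)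
    s = C j (suc j)
    1≤i : 1 ≤ i
    1≤i = ≤-trans 1≤2 2≤i
    2≤j : 2 ≤ j
    2≤j = ≤-trans 2≤i (<⇒≤ i<j)
    j≤n : j ≤ n
    j≤n = <⇒≤ j<n
    i<n : i < n
    i<n = ≤-trans i<j j≤n
    Cij≉0 : ¬ (C i j ≈ 0#)
    Cij≉0 = nonzero-off i j 1≤i (<⇒≤ i<n) (≤-trans 1≤i (<⇒≤ i<j)) j≤n (<⇒≢ i<j)

  expansion : ∀ j k → 2 ℕ.+ k ≤ j → j ≤ n → Expansion (2 ℕ.+ k) j
  expansion j zero _ _ = expansion-row₂ j
  expansion (suc j) (suc k) i≤j j<n with m≤n⇒m<n∨m≡n i≤j
  ... | inj₂ ≡.refl = expansion-diagonal (suc j) (s≤s z≤n) j<n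
  ... | inj₁ (s≤s i<j) = expansion-step (s≤s (s≤s z≤n)) i<j j<n
      (expansion j k (<⇒≤ i<j) j≤n)
      (expansion j (suc k) i<j j≤n)
      (expansion (suc j) k (≤-trans (<⇒≤ i<j) (n≤1+n j)) j<n)
    where
    j≤n : j ≤ n
    j≤n = ≤-trans (n≤1+n j) j<n

  first-row-relation : ∀ i → 1 ≤ i → i ≤ n ∸ 1 →
    C i n * C 1 (suc i) - C (suc i) n * C 1 i ≈ C i (suc i) * C 1 n
  first-row-relation (suc zero) _ _ =
    trans (x-y*z≈x _ (C 2 n) (zero-diag 1 (s≤s z≤n) (≤-trans 1≤2 2≤n))) (*-comm _ _)
  first-row-relation (suc (suc k)) _ i≤n∸1 = *-cancelˡ-≉0 C₁₂≉0 (begin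
    a * (C i n * C 1 (suc i) - C (suc i) n * C 1 i)
      ≈⟨ solve 5 (λ a x u y v → a :* (x :* u :- y :* v) := (a :* x) :* u :- (a :* y) :* v)
                 refl a (C i n) (C 1 (suc i)) (C (suc i) n) (C 1 i) ⟩
    (a * C i n) * C 1 (suc i) - (a * C (suc i) n) * C 1 i
      ≈⟨ +-cong (*-congʳ (expansion n k (<⇒≤ i<n) ≤-refl)) (-‿cong (*-congʳ (expansion n (suc k) i<n ≤-refl))) ⟩
    minor i n * C 1 (suc i) - minor (suc i) n * C 1 i
      ≈⟨ det₂-first-row (column i) (column (suc i)) (column n) ⟩
    minor i (suc i) * C 1 n
      ≈⟨ *-congʳ (expansion-adjacent i (s≤s (s≤s z≤n)) i<n) ⟨
    (a * C i (suc i)) * C 1 n ≈⟨ *-assoc _ _ _ ⟩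
    a * (C i (suc i) * C 1 n) ∎)
    where
    i = suc (suc k)
    a = C 1 2
    i<n : i < n
    i<n = ≤∸1⇒< (≤-trans 1≤2 2≤n) i≤n∸1

proposition4p5 : ∀ {c ℓ} (K : Field c ℓ) (n : ℕ) → 2 ≤ n →
    (C : Matrix K) → IsFriezeMatrix K n C →
    ∀ i → 1 ≤ i → i ≤ n ∸ 1 →
    Field._≈_ K
    (Field._-_ K (Field._*_ K (C i n) (C 1 (suc i))) (Field._*_ K (C (suc i) n) (C 1 i)))
    (Field._*_ K (C i (suc i)) (C 1 n))
proposition4p5 K n 2≤n C F = Frieze.first-row-relation 2≤n F
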